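{- Let $A,B,C$ be tridendriform algebras over a field $\mathbb{K}$ with augmentations $\overline{A},\overline{B},\overline{C}$. Then, under the canonical identification of the underlying vector spaces $(\overline{A}\otimes\overline{B})\otimes\overline{C}\cong\overline{A}\otimes(\overline{B}\otimes\overline{C})$, the tridendriform structures $(A\overline{\otimes}B)\overline{\otimes}C$ and $A\overline{\otimes}(B\overline{\otimes}C)$ (augmented tensor product construction applied twice) coincide.
   Context: A tridendriform algebra is a vector space with three bilinear products $\prec,\cdot,\succ$ such that, with $*=\prec+\cdot+\succ$, for all $a,b,c$: $(a\prec b)\prec c=a\prec(b*c)$; $(a\succ b)\prec c=a\succ(b\prec c)$; $(a*b)\succ c=a\succ(b\succ c)$; $(a\succ b)\cdot c=a\succ(b\cdot c)$; $(a\prec b)\cdot c=a\cdot(b\succ c)$; $(a\cdot b)\prec c=a\cdot(b\prec c)$; $(a\cdot b)\cdot c=a\cdot(b\cdot c)$. The augmentation $\overline{A}=\mathbb{K}1\oplus A$ adjoins a unit $1$ for $*$ with, for $a\in A$: $1\prec a=0$, $a\prec 1=a$, $1\succ a=a$, $a\succ 1=0$, $a\cdot 1=1\cdot a=0$ ($1\ltimes 1$ undefined for $\ltimes\in\{\prec,\cdot,\succ\}$). The augmented tensor product $A\overline{\otimes}B$ is the subspace $(A\otimes B)\oplus(\mathbb{K}1\otimes B)\oplus(A\otimes\mathbb{K}1)$ of $\overline{A}\otimes\overline{B}$ (its augmentation is $\overline{A}\otimes\overline{B}$, with unit $1\otimes1$), with products for $\ltimes\in\{\prec,\cdot,\succ\}$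 defined on pure tensors $a\otimes b,c\otimes d$ (each factor either $1$ or in the augmentation ideal, not both tensors equal to $1\otimes 1$) by $(a\otimes b)\ltimes(c\otimes d)=(a*c)\otimes(b\ltimes d)$ if $b\in B$ or $d\in B$, and $(a\otimes 1)\ltimes(c\otimes 1)=(a\ltimes c)\otimes 1$ otherwise; it is a tridendriform algebra, so the construction can be iterated. -}

module Defs where

open import Level using (0ℓ)
open import Algebra.Bundles using (CommutativeRing)
open import Algebra.Module.Bundles using (Module)
open import Data.Product using (_×_; _,_; Σ)
open import Relation.Nullary using (¬_)

record Field : Set₁ where
  field
    commutativeRing : CommutativeRing 0ℓ 0ℓ
  open CommutativeRing commutativeRing public
  field
    0≉1     : ¬ (0# ≈ 1#)
    inverse : ∀ x → ¬ (x ≈ 0#) → Σ Carrier (λ y → (x * y) ≈ 1#)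

data Op : Set where
  ≺ · ≻ : Op

record TriOps (K : Field) : Set₁ where
  open Field K using () renaming (Carrier to Scalar)
  field
    Car  : Set
    _≈ᵒ_ : Car → Car → Set
    _+ᵒ_ : Car → Car → Car
    _•ᵒ_ : Scalar → Car → Car
    0ᵒ   : Car
    mul  : Op → Car → Car → Car

  _*ᵒ_ : Car → Car → Car
  a *ᵒ b = (mul ≺ a b +ᵒ mul · a b) +ᵒ mul ≻ a b

record TriAlg (K : Field) : Set₁ where
  open Field K using (commutativeRing)
  field
    vecSpace : Module commutativeRing 0ℓ 0ℓ
  open Module vecSpace public
  field
    mul : Op → Carrierᴹ → Carrierᴹ → Carrierᴹ
    mul-cong : ∀ o {a a' b b'} → a ≈ᴹ a' → b ≈ᴹ b' → mul o a b ≈ᴹ mul o a' b'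
    mul-+ˡ   : ∀ o a a' b → mul o (a +ᴹ a') b ≈ᴹ (mul o a b +ᴹ mul o a' b)
    mul-+ʳ   : ∀ o a b b' → mul o a (b +ᴹ b') ≈ᴹ (mul o a b +ᴹ mul o a b')
    mul-*ₗˡ  : ∀ o k a b → mul o (k *ₗ a) b ≈ᴹ (k *ₗ mul o a b)
    mul-*ₗʳ  : ∀ o k a b → mul o a (k *ₗ b) ≈ᴹ (k *ₗ mul o a b)

  field
    ax1 : ∀ a b c → (mul ≺ (mul ≺ a b) c) ≈ᴹ (mul ≺ a ((mul ≺ b c +ᴹ mul · b c) +ᴹ mul ≻ b c))
    ax2 : ∀ a b c → (mul ≺ (mul ≻ a b) c) ≈ᴹ (mul ≻ a (mul ≺ b c))
    ax3 : ∀ a b c → (mul ≻ ((mul ≺ a b +ᴹ mul · a b) +ᴹ mul ≻ a b) c) ≈ᴹ (mul ≻ a (mul ≻ b c))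
    ax4 : ∀ a b c → (mul · (mul ≻ a b) c) ≈ᴹ (mul ≻ a (mul · b c))
    ax5 : ∀ a b c → (mul · (mul ≺ a b) c) ≈ᴹ (mul · a (mul ≻ b c))
    ax6 : ∀ a b c → (mul ≺ (mul · a b) c) ≈ᴹ (mul · a (mul ≺ b c))
    ax7 : ∀ a b c → (mul · (mul · a b) c) ≈ᴹ (mul · a (mul · b c))

  ops : TriOps K
  ops = record
    { Car = Carrierᴹ ; _≈ᵒ_ = _≈ᴹ_ ; _+ᵒ_ = _+ᴹ_ ; _•ᵒ_ = _*ₗ_
    ; 0ᵒ = 0ᴹ ; mul = mul }

-- Tensor product X ⊗ Y of the underlying vector spaces: the free
-- K-vector space on formal symbols x ⊗ y, modulo the congruence
-- generated by the vector space axioms and bilinearity of ⊗.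

module Tensor {K : Field} (X Y : TriOps K) where
  open Field K using (_≈_; _+_; _*_; -_; 1#) renaming (Carrier to Scalar)
  private
    module X = TriOps X
    module Y = TriOps Y

  infixr 8 _⊗_
  data Tm : Set where
    0ᵗ   : Tm
    _⊗_  : X.Car → Y.Car → Tm
    _+ᵗ_ : Tm → Tm → Tm
    _•ᵗ_ : Scalar → Tm → Tm

  data _≈ᵗ_ : Tm → Tm → Set where
    ≈-reflᵗ  : ∀ {s} → s ≈ᵗ s
    ≈-symᵗ   : ∀ {s t} → s ≈ᵗ t → t ≈ᵗ s
    ≈-transᵗ : ∀ {s t u} → s ≈ᵗ t → t ≈ᵗ u → s ≈ᵗ u
    +-congᵗ  : ∀ {s s' t t'} → s ≈ᵗ s' → t ≈ᵗ t' → (s +ᵗ t) ≈ᵗ (s' +ᵗ t')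
    •-congᵗ  : ∀ {k k' t t'} → k ≈ k' → t ≈ᵗ t' → (k •ᵗ t) ≈ᵗ (k' •ᵗ t')
    ⊗-congᵗ  : ∀ {x x' y y'} → x X.≈ᵒ x' → y Y.≈ᵒ y' → (x ⊗ y) ≈ᵗ (x' ⊗ y')
    +-assocᵗ : ∀ s t u → ((s +ᵗ t) +ᵗ u) ≈ᵗ (s +ᵗ (t +ᵗ u))
    +-commᵗ  : ∀ s t → (s +ᵗ t) ≈ᵗ (t +ᵗ s)
    +-idˡᵗ   : ∀ t → (0ᵗ +ᵗ t) ≈ᵗ t
    +-invᵗ   : ∀ t → (t +ᵗ ((- 1#) •ᵗ t)) ≈ᵗ 0ᵗ
    •-distˡᵗ : ∀ k s t → (k •ᵗ (s +ᵗ t)) ≈ᵗ ((k •ᵗ s) +ᵗ (k •ᵗ t))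
    •-distʳᵗ : ∀ k l t → ((k + l) •ᵗ t) ≈ᵗ ((k •ᵗ t) +ᵗ (l •ᵗ t))
    •-assocᵗ : ∀ k l t → ((k * l) •ᵗ t) ≈ᵗ (k •ᵗ (l •ᵗ t))
    •-idᵗ    : ∀ t → (1# •ᵗ t) ≈ᵗ t
    ⊗-+ˡᵗ    : ∀ x x' y → ((x X.+ᵒ x') ⊗ y) ≈ᵗ ((x ⊗ y) +ᵗ (x' ⊗ y))
    ⊗-+ʳᵗ    : ∀ x y y' → (x ⊗ (y Y.+ᵒ y')) ≈ᵗ ((x ⊗ y) +ᵗ (x ⊗ y'))
    ⊗-•ˡᵗ    : ∀ k x y → ((k X.•ᵒ x) ⊗ y) ≈ᵗ (k •ᵗ (x ⊗ y))
    ⊗-•ʳᵗ    : ∀ k x y → (x ⊗ (k Y.•ᵒ y)) ≈ᵗ (k •ᵗ (x ⊗ y))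

  lin : {R : Set} → R → (R → R → R) → (Scalar → R → R) →
        (X.Car → Y.Car → R) → Tm → R
  lin z p s g 0ᵗ         = z
  lin z p s g (x ⊗ y)    = g x y
  lin z p s g (t +ᵗ t')  = p (lin z p s g t) (lin z p s g t')
  lin z p s g (k •ᵗ t)   = s k (lin z p s g t)

-- The augmentation: elements 1 or a ∈ A (used for pure tensor factors).

data Aug (S : Set) : Set where
  one : Aug S
  el  : S → Aug S

-- The augmented tensor product X ⊗̄ Y, with underlying space
--   (X ⊗ Y) ⊕ (K1 ⊗ Y) ⊕ (X ⊗ K1)  ≅  (X ⊗ Y) × Y × X.

module AugTensor {K : Field} (X Y : TriOps K) where
  open Field K using () renaming (Carrier to Scalar)
  open Tensor X Y public
  private
    module X = TriOps X
    module Y = TriOps Y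

  Car : Set
  Car = Tm × Y.Car × X.Car

  _≈ᶜ_ : Car → Car → Set
  (t , y , x) ≈ᶜ (t' , y' , x') = (t ≈ᵗ t') × (y Y.≈ᵒ y') × (x X.≈ᵒ x')

  _+ᶜ_ : Car → Car → Car
  (t , y , x) +ᶜ (t' , y' , x') = (t +ᵗ t') , (y Y.+ᵒ y') , (x X.+ᵒ x')

  _•ᶜ_ : Scalar → Car → Car
  k •ᶜ (t , y , x) = (k •ᵗ t) , (k Y.•ᵒ y) , (k X.•ᵒ x)

  0ᶜ : Car
  0ᶜ = 0ᵗ , Y.0ᵒ , X.0ᵒ

  _*̄_ : Aug X.Car → Aug X.Car → Aug X.Car
  one  *̄ one  = one
  one  *̄ el c = el c
  el a *̄ one  = el a
  el a *̄ el c = el (a X.*ᵒ c)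

  -- u ⊗ y for u ∈ X̄ and y ∈ Y, as an element of X ⊗̄ Y
  embed : Aug X.Car → Y.Car → Car
  embed one    y = 0ᵗ , y , X.0ᵒ
  embed (el x) y = (x ⊗ y) , Y.0ᵒ , X.0ᵒ

  ⋉1 : Op → Y.Car → Y.Car
  ⋉1 ≺ b = b
  ⋉1 · b = Y.0ᵒ
  ⋉1 ≻ b = Y.0ᵒ

  1⋉ : Op → Y.Car → Y.Car
  1⋉ ≺ d = Y.0ᵒ
  1⋉ · d = Y.0ᵒ
  1⋉ ≻ d = d

  -- pure tensors other than 1 ⊗ 1:  u ⊗ y (u ∈ X̄, y ∈ Y) and x ⊗ 1 (x ∈ X)
  data Gen : Set where
    genY : Aug X.Car → Y.Car → Gen
    genX : X.Car → Gen

  mulGen : Op → Gen → Gen → Car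
  mulGen o (genY u y) (genY u' y') = embed (u *̄ u') (Y.mul o y y')
  mulGen o (genY u y) (genX c)     = embed (u *̄ el c) (⋉1 o y)
  mulGen o (genX a)   (genY u' d)  = embed (el a *̄ u') (1⋉ o d)
  mulGen o (genX a)   (genX c)     = 0ᵗ , Y.0ᵒ , X.mul o a c

  ext : (Gen → Car) → Car → Car
  ext g (t , y , x) =
    (lin 0ᶜ _+ᶜ_ _•ᶜ_ (λ a b → g (genY (el a) b)) t +ᶜ g (genY one y))
      +ᶜ g (genX x)

  mulᶜ : Op → Car → Car → Car
  mulᶜ o p q = ext (λ g → ext (λ g' → mulGen o g g') q) p

infixl 6 _⊗̄_
_⊗̄_ : {K : Field} → TriOps K → TriOps K → TriOps K
X ⊗̄ Y = record
  { Car = Car ; _≈ᵒ_ = _≈ᶜ_ ; _+ᵒ_ = _+ᶜ_ ; _•ᵒ_ = _•ᶜ_ ; 0ᵒ = 0ᶜ ; mul = mulᶜ }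
  where open AugTensor X Y

-- The canonical identification (X̄ ⊗ Ȳ) ⊗ Z̄ ≅ X̄ ⊗ (Ȳ ⊗ Z̄), restricted to
-- the augmentation ideals:  (X ⊗̄ Y) ⊗̄ Z → X ⊗̄ (Y ⊗̄ Z),
-- a ⊗ b ⊗ c ↦ a ⊗ (b ⊗ c) on pure tensors (each factor 1 or in the ideal),
-- extended linearly.

module Assoc {K : Field} (X Y Z : TriOps K) where
  private
    module X = TriOps X
    module Y = TriOps Y
    module Z = TriOps Z
    module XY   = AugTensor X Y
    module YZ   = AugTensor Y Z
    module XY-Z = AugTensor (X ⊗̄ Y) Z
    module X-YZ = AugTensor X (Y ⊗̄ Z)
    module R    = TriOps (X ⊗̄ (Y ⊗̄ Z))

  -- 1 ⊗ 1 ⊗ c ↦ 1 ⊗ (1 ⊗ c)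
  φ11c : Z.Car → R.Car
  φ11c c = X-YZ.0ᵗ , (YZ.0ᵗ , c , Y.0ᵒ) , X.0ᵒ

  -- elements of X ⊗̄ Y, i.e. tensors a⊗b⊗1, 1⊗b⊗1, a⊗1⊗1
  φXY1 : TriOps.Car (X ⊗̄ Y) → R.Car
  φXY1 (t , b , a) =
    (XY.lin R.0ᵒ R._+ᵒ_ R._•ᵒ_
        (λ a b → (a X-YZ.⊗ (YZ.0ᵗ , Z.0ᵒ , b)) , TriOps.0ᵒ (Y ⊗̄ Z) , X.0ᵒ) t
      R.+ᵒ (X-YZ.0ᵗ , (YZ.0ᵗ , Z.0ᵒ , b) , X.0ᵒ))
      R.+ᵒ (X-YZ.0ᵗ , TriOps.0ᵒ (Y ⊗̄ Z) , a)

  -- p ⊗ c for p ∈ X ⊗̄ Y and c ∈ Z: tensors a⊗b⊗c, 1⊗b⊗c, a⊗1⊗c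
  φgen : TriOps.Car (X ⊗̄ Y) → Z.Car → R.Car
  φgen (t , b , a) c =
    (XY.lin R.0ᵒ R._+ᵒ_ R._•ᵒ_
        (λ a b → (a X-YZ.⊗ ((b YZ.⊗ c) , Z.0ᵒ , Y.0ᵒ)) , TriOps.0ᵒ (Y ⊗̄ Z) , X.0ᵒ) t
      R.+ᵒ (X-YZ.0ᵗ , ((b YZ.⊗ c) , Z.0ᵒ , Y.0ᵒ) , X.0ᵒ))
      R.+ᵒ ((a X-YZ.⊗ (YZ.0ᵗ , c , Y.0ᵒ)) , TriOps.0ᵒ (Y ⊗̄ Z) , X.0ᵒ)

  φ : TriOps.Car ((X ⊗̄ Y) ⊗̄ Z) → R.Car
  φ (T , c , p) =
    (XY-Z.lin R.0ᵒ R._+ᵒ_ R._•ᵒ_ φgen T R.+ᵒ φ11c c) R.+ᵒ φXY1 p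

-- Both sides are bilinear in (p , q) and φ is linear, so it suffices to compare them on pure
-- tensors of (A ⊗̄ B) ⊗̄ C; as these involve arbitrary elements of A ⊗̄ B, linearity once more
-- reduces everything to pure triples α ⊗ β ⊗ γ, each factor being 1 or in the ideal. On pure
-- triples both iterated constructions follow the same rule: the product ⋉ is taken in the last
-- position where one of the two triples is not 1, and * (with unit 1) in the positions before.
module Submission where

open import Level using (0ℓ)
open import Data.Product using (_,_; proj₁)
open import Relation.Binary.Structures using (IsEquivalence)
open import Relation.Binary.Bundles using (Setoid)
open import Relation.Binary.PropositionalEquality as ≡ using (_≡_)
open import Algebra.Bundles using (CommutativeSemigroup)
import Algebra.Properties.CommutativeSemigroup as CommutativeSemigroupProperties
import Relation.Binary.Reasoning.Setoid as SetoidReasoning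
open import Defs

module _ {K : Field} where
  private
    module K = Field K
  open K using (_≈_; _+_; _*_; -_; 0#; 1#) renaming (Carrier to Scalar)

  record IsVectorSpace (X : TriOps K) : Set where
    open TriOps X
    field
      isEquivalence : IsEquivalence _≈ᵒ_
      +-cong        : ∀ {x x' y y'} → x ≈ᵒ x' → y ≈ᵒ y' → (x +ᵒ y) ≈ᵒ (x' +ᵒ y')
      •-cong        : ∀ {k k' x x'} → k ≈ k' → x ≈ᵒ x' → (k •ᵒ x) ≈ᵒ (k' •ᵒ x')
      +-assoc       : ∀ x y z → ((x +ᵒ y) +ᵒ z) ≈ᵒ (x +ᵒ (y +ᵒ z))
      +-comm        : ∀ x y → (x +ᵒ y) ≈ᵒ (y +ᵒ x)
      +-identityˡ   : ∀ x → (0ᵒ +ᵒ x) ≈ᵒ x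
      +-inverseʳ    : ∀ x → (x +ᵒ ((- 1#) •ᵒ x)) ≈ᵒ 0ᵒ
      •-distribˡ    : ∀ k x y → (k •ᵒ (x +ᵒ y)) ≈ᵒ ((k •ᵒ x) +ᵒ (k •ᵒ y))
      •-distribʳ    : ∀ k l x → ((k + l) •ᵒ x) ≈ᵒ ((k •ᵒ x) +ᵒ (l •ᵒ x))
      •-assoc       : ∀ k l x → ((k * l) •ᵒ x) ≈ᵒ (k •ᵒ (l •ᵒ x))
      •-identityˡ   : ∀ x → (1# •ᵒ x) ≈ᵒ x

    open IsEquivalence isEquivalence public

    setoid : Setoid 0ℓ 0ℓ
    setoid = record { isEquivalence = isEquivalence }

    module ≈-Reasoning = SetoidReasoning setoid

    +-commutativeSemigroup : CommutativeSemigroup 0ℓ 0ℓ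
    +-commutativeSemigroup = record
      { isCommutativeSemigroup = record
        { isSemigroup = record
          { isMagma = record { isEquivalence = isEquivalence ; ∙-cong = +-cong }
          ; assoc   = +-assoc }
        ; comm = +-comm } }

    open CommutativeSemigroupProperties +-commutativeSemigroup public
      using (interchange)

    +-identityʳ : ∀ x → (x +ᵒ 0ᵒ) ≈ᵒ x
    +-identityʳ x = trans (+-comm x 0ᵒ) (+-identityˡ x)

    0≈0+0 : 0ᵒ ≈ᵒ (0ᵒ +ᵒ 0ᵒ)
    0≈0+0 = sym (+-identityˡ 0ᵒ)

    •-zeroˡ : ∀ x → (0# •ᵒ x) ≈ᵒ 0ᵒ
    •-zeroˡ x = begin
      y                              ≈⟨ +-identityʳ y ⟨
      y +ᵒ 0ᵒ                        ≈⟨ +-cong refl (+-inverseʳ y) ⟨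
      y +ᵒ (y +ᵒ -y)                 ≈⟨ +-assoc y y -y ⟨
      (y +ᵒ y) +ᵒ -y                 ≈⟨ +-cong y+y≈y refl ⟩
      y +ᵒ -y                        ≈⟨ +-inverseʳ y ⟩
      0ᵒ                             ∎
      where
      open ≈-Reasoning
      y = 0# •ᵒ x
      -y = (- 1#) •ᵒ y
      y+y≈y : (y +ᵒ y) ≈ᵒ y
      y+y≈y = trans (sym (•-distribʳ 0# 0# x)) (•-cong (K.+-identityˡ 0#) refl)

    •-zeroʳ : ∀ k → (k •ᵒ 0ᵒ) ≈ᵒ 0ᵒ
    •-zeroʳ k = begin
      k •ᵒ 0ᵒ            ≈⟨ •-cong K.refl (•-zeroˡ 0ᵒ) ⟨
      k •ᵒ (0# •ᵒ 0ᵒ)    ≈⟨ •-assoc k 0# 0ᵒ ⟨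
      (k * 0#) •ᵒ 0ᵒ     ≈⟨ •-cong (K.zeroʳ k) refl ⟩
      0# •ᵒ 0ᵒ           ≈⟨ •-zeroˡ 0ᵒ ⟩
      0ᵒ                 ∎
      where open ≈-Reasoning

    •-comm : ∀ k l x → (l •ᵒ (k •ᵒ x)) ≈ᵒ (k •ᵒ (l •ᵒ x))
    •-comm k l x = trans (sym (•-assoc l k x)) (trans (•-cong (K.*-comm l k) refl) (•-assoc k l x))

  record IsLinear (S T : TriOps K) (f : TriOps.Car S → TriOps.Car T) : Set where
    private
      module S = TriOps S
      module T = TriOps T
    field
      cong   : ∀ {x y} → x S.≈ᵒ y → f x T.≈ᵒ f y
      +-homo : ∀ x y → f (x S.+ᵒ y) T.≈ᵒ (f x T.+ᵒ f y)
      •-homo : ∀ k x → f (k S.•ᵒ x) T.≈ᵒ (k T.•ᵒ f x)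

  module _ {S T : TriOps K} (VS : IsVectorSpace S) (VT : IsVectorSpace T) where
    private
      module S = TriOps S
      module T = TriOps T
      module VS = IsVectorSpace VS
      module VT = IsVectorSpace VT

    0-homo : ∀ {f} → IsLinear S T f → f S.0ᵒ T.≈ᵒ T.0ᵒ
    0-homo {f} L = VT.trans (cong (VS.sym (VS.•-zeroˡ S.0ᵒ)))
                    (VT.trans (•-homo 0# S.0ᵒ) (VT.•-zeroˡ (f S.0ᵒ)))
      where open IsLinear L

    0-isLinear : IsLinear S T (λ _ → T.0ᵒ)
    0-isLinear = record
      { cong   = λ _ → VT.refl
      ; +-homo = λ _ _ → VT.0≈0+0
      ; •-homo = λ k _ → VT.sym (VT.•-zeroʳ k) }

    +-isLinear : ∀ {f g} → IsLinear S T f → IsLinear S T g → IsLinear S T (λ x → f x T.+ᵒ g x)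
    +-isLinear Lf Lg = record
      { cong   = λ e → VT.+-cong (F.cong e) (G.cong e)
      ; +-homo = λ x y → VT.trans (VT.+-cong (F.+-homo x y) (G.+-homo x y)) (VT.interchange _ _ _ _)
      ; •-homo = λ k x → VT.trans (VT.+-cong (F.•-homo k x) (G.•-homo k x)) (VT.sym (VT.•-distribˡ k _ _)) }
      where
      module F = IsLinear Lf
      module G = IsLinear Lg

  id-isLinear : ∀ {S} → IsVectorSpace S → IsLinear S S (λ x → x)
  id-isLinear VS = record { cong = λ e → e ; +-homo = λ _ _ → refl ; •-homo = λ _ _ → refl }
    where open IsVectorSpace VS

  ∘-isLinear : ∀ {S T U} → IsVectorSpace U → ∀ {f g} →
               IsLinear S T f → IsLinear T U g → IsLinear S U (λ x → g (f x))
  ∘-isLinear VU Lf Lg = record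
    { cong   = λ e → G.cong (F.cong e)
    ; +-homo = λ x y → trans (G.cong (F.+-homo x y)) (G.+-homo _ _)
    ; •-homo = λ k x → trans (G.cong (F.•-homo k x)) (G.•-homo _ _) }
    where
    open IsVectorSpace VU
    module F = IsLinear Lf
    module G = IsLinear Lg

  record IsBilinear (X : TriOps K) : Set where
    open TriOps X
    field
      isVectorSpace : IsVectorSpace X
      mul-linearˡ   : ∀ o y → IsLinear X X (λ x → mul o x y)
      mul-linearʳ   : ∀ o x → IsLinear X X (λ y → mul o x y)

    mul-cong : ∀ o {x x' y y'} → x ≈ᵒ x' → y ≈ᵒ y' → mul o x y ≈ᵒ mul o x' y'
    mul-cong o e e' = IsVectorSpace.trans isVectorSpace
      (IsLinear.cong (mul-linearˡ o _) e) (IsLinear.cong (mul-linearʳ o _) e')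

  triAlg-isBilinear : (A : TriAlg K) → IsBilinear (TriAlg.ops A)
  triAlg-isBilinear A = record
    { isVectorSpace = record
      { isEquivalence = ≈ᴹ-isEquivalence
      ; +-cong = +ᴹ-cong ; •-cong = *ₗ-cong ; +-assoc = +ᴹ-assoc ; +-comm = +ᴹ-comm
      ; +-identityˡ = +ᴹ-identityˡ
      ; +-inverseʳ = λ x → ≈ᴹ-trans (+ᴹ-cong (≈ᴹ-sym (*ₗ-identityˡ x)) ≈ᴹ-refl)
                     (≈ᴹ-trans (≈ᴹ-sym (*ₗ-distribʳ x 1# (- 1#)))
                     (≈ᴹ-trans (*ₗ-cong (K.-‿inverseʳ 1#) ≈ᴹ-refl) (*ₗ-zeroˡ x)))
      ; •-distribˡ = *ₗ-distribˡ ; •-distribʳ = λ k l x → *ₗ-distribʳ x k l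
      ; •-assoc = *ₗ-assoc ; •-identityˡ = *ₗ-identityˡ }
    ; mul-linearˡ = λ o y → record
      { cong = λ e → mul-cong o e ≈ᴹ-refl ; +-homo = λ x x' → mul-+ˡ o x x' y
      ; •-homo = λ k x → mul-*ₗˡ o k x y }
    ; mul-linearʳ = λ o x → record
      { cong = λ e → mul-cong o ≈ᴹ-refl e ; +-homo = λ y y' → mul-+ʳ o x y y'
      ; •-homo = λ k y → mul-*ₗʳ o k x y } }
    where open TriAlg A

  *-linearˡ : ∀ {X} → IsBilinear X → ∀ c → IsLinear X X (λ a → TriOps._*ᵒ_ X a c)
  *-linearˡ BX c = +-isLinear V V (+-isLinear V V (mul-linearˡ ≺ c) (mul-linearˡ · c)) (mul-linearˡ ≻ c)
    where open IsBilinear BX renaming (isVectorSpace to V)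

  *-linearʳ : ∀ {X} → IsBilinear X → ∀ a → IsLinear X X (λ c → TriOps._*ᵒ_ X a c)
  *-linearʳ BX a = +-isLinear V V (+-isLinear V V (mul-linearʳ ≺ a) (mul-linearʳ · a)) (mul-linearʳ ≻ a)
    where open IsBilinear BX renaming (isVectorSpace to V)

  module AugTensorProperties {X Y : TriOps K} (BX : IsBilinear X) (BY : IsBilinear Y) where
    open AugTensor X Y public
    private
      module X = TriOps X
      module Y = TriOps Y
      module BX = IsBilinear BX
      module BY = IsBilinear BY
      module VX = IsVectorSpace BX.isVectorSpace
      module VY = IsVectorSpace BY.isVectorSpace
    module T = TriOps (X ⊗̄ Y)

    isVectorSpace : IsVectorSpace (X ⊗̄ Y)
    isVectorSpace = record
      { isEquivalence = record
        { refl  = ≈-reflᵗ , VY.refl , VX.refl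
        ; sym   = λ (s , y , x) → ≈-symᵗ s , VY.sym y , VX.sym x
        ; trans = λ (s , y , x) (s' , y' , x') → ≈-transᵗ s s' , VY.trans y y' , VX.trans x x' }
      ; +-cong = λ (s , y , x) (s' , y' , x') → +-congᵗ s s' , VY.+-cong y y' , VX.+-cong x x'
      ; •-cong = λ k (s , y , x) → •-congᵗ k s , VY.•-cong k y , VX.•-cong k x
      ; +-assoc     = λ _ _ _ → +-assocᵗ _ _ _ , VY.+-assoc _ _ _ , VX.+-assoc _ _ _
      ; +-comm      = λ _ _ → +-commᵗ _ _ , VY.+-comm _ _ , VX.+-comm _ _
      ; +-identityˡ = λ _ → +-idˡᵗ _ , VY.+-identityˡ _ , VX.+-identityˡ _
      ; +-inverseʳ  = λ _ → +-invᵗ _ , VY.+-inverseʳ _ , VX.+-inverseʳ _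
      ; •-distribˡ  = λ _ _ _ → •-distˡᵗ _ _ _ , VY.•-distribˡ _ _ _ , VX.•-distribˡ _ _ _
      ; •-distribʳ  = λ _ _ _ → •-distʳᵗ _ _ _ , VY.•-distribʳ _ _ _ , VX.•-distribʳ _ _ _
      ; •-assoc     = λ _ _ _ → •-assocᵗ _ _ _ , VY.•-assoc _ _ _ , VX.•-assoc _ _ _
      ; •-identityˡ = λ _ → •-idᵗ _ , VY.•-identityˡ _ , VX.•-identityˡ _ }

    private
      module VT = IsVectorSpace isVectorSpace

    *̄-identityˡ : ∀ u → one *̄ u ≡ u
    *̄-identityˡ one    = ≡.refl
    *̄-identityˡ (el _) = ≡.refl

    *̄-identityʳ : ∀ u → u *̄ one ≡ u
    *̄-identityʳ one    = ≡.refl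
    *̄-identityʳ (el _) = ≡.refl

    pure : Gen → Car
    pure (genY u y) = embed u y
    pure (genX x)   = 0ᵗ , Y.0ᵒ , x

    record IsMultilinear (V : TriOps K) (h : Gen → TriOps.Car V) : Set where
      field
        genY-linearʳ : ∀ u → IsLinear Y V (λ y → h (genY u y))
        genY-linearˡ : ∀ y → IsLinear X V (λ a → h (genY (el a) y))
        genX-linear : IsLinear X V (λ x → h (genX x))

    ∘-isMultilinear : ∀ {V W} → IsVectorSpace W → ∀ {f h} →
                      IsLinear V W f → IsMultilinear V h → IsMultilinear W (λ γ → f (h γ))
    ∘-isMultilinear VW Lf Mh = record
      { genY-linearʳ = λ u → ∘-isLinear VW (genY-linearʳ u) Lf
      ; genY-linearˡ = λ y → ∘-isLinear VW (genY-linearˡ y) Lf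
      ; genX-linear = ∘-isLinear VW genX-linear Lf }
      where open IsMultilinear Mh

    private
      0ᵗ≈•0ᵗ : ∀ k → 0ᵗ ≈ᵗ (k •ᵗ 0ᵗ)
      0ᵗ≈•0ᵗ k = ≈-symᵗ (proj₁ (VT.•-zeroʳ k))

    embed-isLinear : ∀ u → IsLinear Y (X ⊗̄ Y) (embed u)
    embed-isLinear one = record
      { cong   = λ e → ≈-reflᵗ , e , VX.refl
      ; +-homo = λ _ _ → ≈-symᵗ (+-idˡᵗ 0ᵗ) , VY.refl , VX.0≈0+0
      ; •-homo = λ k _ → 0ᵗ≈•0ᵗ k , VY.refl , VX.sym (VX.•-zeroʳ k) }
    embed-isLinear (el a) = record
      { cong   = λ e → ⊗-congᵗ VX.refl e , VY.refl , VX.refl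
      ; +-homo = λ y y' → ⊗-+ʳᵗ a y y' , VY.0≈0+0 , VX.0≈0+0
      ; •-homo = λ k y → ⊗-•ʳᵗ k a y , VY.sym (VY.•-zeroʳ k) , VX.sym (VX.•-zeroʳ k) }

    embed-cong : ∀ u {u' y y'} → u ≡ u' → y Y.≈ᵒ y' → embed u y T.≈ᵒ embed u' y'
    embed-cong u ≡.refl y≈y' = IsLinear.cong (embed-isLinear u) y≈y'

    embed-zero : ∀ u → embed u Y.0ᵒ T.≈ᵒ T.0ᵒ
    embed-zero u = 0-homo BY.isVectorSpace isVectorSpace (embed-isLinear u)

    embed-isLinearˡ : ∀ y → IsLinear X (X ⊗̄ Y) (λ a → embed (el a) y)
    embed-isLinearˡ y = record
      { cong   = λ e → ⊗-congᵗ e VY.refl , VY.refl , VX.refl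
      ; +-homo = λ a a' → ⊗-+ˡᵗ a a' y , VY.0≈0+0 , VX.0≈0+0
      ; •-homo = λ k a → ⊗-•ˡᵗ k a y , VY.sym (VY.•-zeroʳ k) , VX.sym (VX.•-zeroʳ k) }

    pure-genX-isLinear : IsLinear X (X ⊗̄ Y) (λ x → pure (genX x))
    pure-genX-isLinear = record
      { cong   = λ e → ≈-reflᵗ , VY.refl , e
      ; +-homo = λ _ _ → ≈-symᵗ (+-idˡᵗ 0ᵗ) , VY.0≈0+0 , VX.refl
      ; •-homo = λ k _ → 0ᵗ≈•0ᵗ k , VY.sym (VY.•-zeroʳ k) , VX.refl }

    module Extension {V : TriOps K} (VV : IsVectorSpace V) where
      private
        module V = TriOps V
        module VV = IsVectorSpace VV

      extendᵗ : (X.Car → Y.Car → V.Car) → Tm → V.Car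
      extendᵗ = lin V.0ᵒ V._+ᵒ_ V._•ᵒ_

      -- For V = X ⊗̄ Y this is AugTensor.ext, so mulᶜ o p q is definitionally
      -- extend (λ γ → extend (mulGen o γ) q) p.
      extend : (Gen → V.Car) → Car → V.Car
      extend h (t , y , x) = (extendᵗ (λ a b → h (genY (el a) b)) t V.+ᵒ h (genY one y)) V.+ᵒ h (genX x)

      module _ {h : Gen → V.Car} (Mh : IsMultilinear V h) where
        open IsMultilinear Mh

        -- Each generating relation of ≈ᵗ becomes a vector space law of V or a linearity law of h.
        extendᵗ-cong : ∀ {s t} → s ≈ᵗ t →
                       extendᵗ (λ a b → h (genY (el a) b)) s V.≈ᵒ extendᵗ (λ a b → h (genY (el a) b)) t
        extendᵗ-cong ≈-reflᵗ                = VV.refl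
        extendᵗ-cong (≈-symᵗ e)             = VV.sym (extendᵗ-cong e)
        extendᵗ-cong (≈-transᵗ e e')        = VV.trans (extendᵗ-cong e) (extendᵗ-cong e')
        extendᵗ-cong (+-congᵗ e e')         = VV.+-cong (extendᵗ-cong e) (extendᵗ-cong e')
        extendᵗ-cong (•-congᵗ k e)          = VV.•-cong k (extendᵗ-cong e)
        extendᵗ-cong (⊗-congᵗ ex ey)        = VV.trans (IsLinear.cong (genY-linearˡ _) ex) (IsLinear.cong (genY-linearʳ (el _)) ey)
        extendᵗ-cong (+-assocᵗ _ _ _)       = VV.+-assoc _ _ _
        extendᵗ-cong (+-commᵗ _ _)          = VV.+-comm _ _
        extendᵗ-cong (+-idˡᵗ _)             = VV.+-identityˡ _
        extendᵗ-cong (+-invᵗ _)             = VV.+-inverseʳ _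
        extendᵗ-cong (•-distˡᵗ _ _ _)       = VV.•-distribˡ _ _ _
        extendᵗ-cong (•-distʳᵗ _ _ _)       = VV.•-distribʳ _ _ _
        extendᵗ-cong (•-assocᵗ _ _ _)       = VV.•-assoc _ _ _
        extendᵗ-cong (•-idᵗ _)              = VV.•-identityˡ _
        extendᵗ-cong (⊗-+ˡᵗ x x' y)         = IsLinear.+-homo (genY-linearˡ y) x x'
        extendᵗ-cong (⊗-+ʳᵗ x y y')         = IsLinear.+-homo (genY-linearʳ (el x)) y y'
        extendᵗ-cong (⊗-•ˡᵗ k x y)          = IsLinear.•-homo (genY-linearˡ y) k x
        extendᵗ-cong (⊗-•ʳᵗ k x y)          = IsLinear.•-homo (genY-linearʳ (el x)) k y

        extend-isLinear : IsLinear (X ⊗̄ Y) V (extend h)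
        extend-isLinear = record
          { cong   = λ (s , y , x) → VV.+-cong (VV.+-cong (extendᵗ-cong s) (Y₁.cong y)) (X₁.cong x)
          ; +-homo = λ _ _ → VV.trans (VV.+-cong (VV.+-cong VV.refl (Y₁.+-homo _ _)) (X₁.+-homo _ _))
                               (VV.trans (VV.+-cong (VV.interchange _ _ _ _) VV.refl) (VV.interchange _ _ _ _))
          ; •-homo = λ k _ → VV.trans (VV.+-cong (VV.+-cong VV.refl (Y₁.•-homo _ _)) (X₁.•-homo _ _))
                               (VV.sym (VV.trans (VV.•-distribˡ _ _ _) (VV.+-cong (VV.•-distribˡ _ _ _) VV.refl))) }
          where
          module Y₁ = IsLinear (genY-linearʳ one)
          module X₁ = IsLinear genX-linear

        extend-pure : ∀ γ → extend h (pure γ) V.≈ᵒ h γ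
        extend-pure (genY one y) =
          VV.trans (VV.+-cong (VV.+-identityˡ _) (0-homo BX.isVectorSpace VV genX-linear)) (VV.+-identityʳ _)
        extend-pure (genY (el a) y) = VV.trans
          (VV.+-cong (VV.+-cong VV.refl (0-homo BY.isVectorSpace VV (genY-linearʳ one))) (0-homo BX.isVectorSpace VV genX-linear))
          (VV.trans (VV.+-identityʳ _) (VV.+-identityʳ _))
        extend-pure (genX x) =
          VV.trans (VV.+-cong (VV.trans (VV.+-identityˡ _) (0-homo BY.isVectorSpace VV (genY-linearʳ one))) VV.refl) (VV.+-identityˡ _)

      module _ (h h' : Gen → V.Car) (h≈h' : ∀ γ → h γ V.≈ᵒ h' γ) where
        extendᵗ-congʰ : ∀ t → extendᵗ (λ a b → h (genY (el a) b)) t V.≈ᵒ extendᵗ (λ a b → h' (genY (el a) b)) t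
        extendᵗ-congʰ 0ᵗ       = VV.refl
        extendᵗ-congʰ (a ⊗ b)  = h≈h' _
        extendᵗ-congʰ (s +ᵗ t) = VV.+-cong (extendᵗ-congʰ s) (extendᵗ-congʰ t)
        extendᵗ-congʰ (k •ᵗ t) = VV.•-cong K.refl (extendᵗ-congʰ t)

        extend-congʰ : ∀ p → extend h p V.≈ᵒ extend h' p
        extend-congʰ (t , _ , _) = VV.+-cong (VV.+-cong (extendᵗ-congʰ t) (h≈h' _)) (h≈h' _)

      module _ (h h₁ h₂ : Gen → V.Car) (h≈h₁+h₂ : ∀ γ → h γ V.≈ᵒ (h₁ γ V.+ᵒ h₂ γ)) where
        extendᵗ-+ʰ : ∀ t → extendᵗ (λ a b → h (genY (el a) b)) t V.≈ᵒ
                           (extendᵗ (λ a b → h₁ (genY (el a) b)) t V.+ᵒ extendᵗ (λ a b → h₂ (genY (el a) b)) t)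
        extendᵗ-+ʰ 0ᵗ       = VV.0≈0+0
        extendᵗ-+ʰ (a ⊗ b)  = h≈h₁+h₂ _
        extendᵗ-+ʰ (s +ᵗ t) = VV.trans (VV.+-cong (extendᵗ-+ʰ s) (extendᵗ-+ʰ t)) (VV.interchange _ _ _ _)
        extendᵗ-+ʰ (k •ᵗ t) = VV.trans (VV.•-cong K.refl (extendᵗ-+ʰ t)) (VV.•-distribˡ _ _ _)

        extend-+ʰ : ∀ p → extend h p V.≈ᵒ (extend h₁ p V.+ᵒ extend h₂ p)
        extend-+ʰ (t , _ , _) = VV.trans (VV.+-cong (VV.+-cong (extendᵗ-+ʰ t) (h≈h₁+h₂ _)) (h≈h₁+h₂ _))
                                  (VV.trans (VV.+-cong (VV.interchange _ _ _ _) VV.refl) (VV.interchange _ _ _ _))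

      module _ (k : Scalar) (h h₁ : Gen → V.Car) (h≈k•h₁ : ∀ γ → h γ V.≈ᵒ (k V.•ᵒ h₁ γ)) where
        extendᵗ-•ʰ : ∀ t → extendᵗ (λ a b → h (genY (el a) b)) t V.≈ᵒ (k V.•ᵒ extendᵗ (λ a b → h₁ (genY (el a) b)) t)
        extendᵗ-•ʰ 0ᵗ       = VV.sym (VV.•-zeroʳ k)
        extendᵗ-•ʰ (a ⊗ b)  = h≈k•h₁ _
        extendᵗ-•ʰ (s +ᵗ t) = VV.trans (VV.+-cong (extendᵗ-•ʰ s) (extendᵗ-•ʰ t)) (VV.sym (VV.•-distribˡ _ _ _))
        extendᵗ-•ʰ (l •ᵗ t) = VV.trans (VV.•-cong K.refl (extendᵗ-•ʰ t)) (VV.•-comm k l _)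

        extend-•ʰ : ∀ p → extend h p V.≈ᵒ (k V.•ᵒ extend h₁ p)
        extend-•ʰ (t , _ , _) = VV.trans (VV.+-cong (VV.+-cong (extendᵗ-•ʰ t) (h≈k•h₁ _)) (h≈k•h₁ _))
                                  (VV.sym (VV.trans (VV.•-distribˡ _ _ _) (VV.+-cong (VV.•-distribˡ _ _ _) VV.refl)))

      extend-linear-in-family : ∀ {S : TriOps K} (H : TriOps.Car S → Gen → V.Car) →
                                (∀ γ → IsLinear S V (λ s → H s γ)) → ∀ p → IsLinear S V (λ s → extend (H s) p)
      extend-linear-in-family H LH p = record
        { cong   = λ e → extend-congʰ _ _ (λ γ → IsLinear.cong (LH γ) e) p
        ; +-homo = λ s s' → extend-+ʰ _ _ _ (λ γ → IsLinear.+-homo (LH γ) s s') p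
        ; •-homo = λ k s → extend-•ʰ k _ _ (λ γ → IsLinear.•-homo (LH γ) k s) p }

      linear-ext : (F G : Car → V.Car) → IsLinear (X ⊗̄ Y) V F → IsLinear (X ⊗̄ Y) V G →
                   (∀ γ → F (pure γ) V.≈ᵒ G (pure γ)) → ∀ p → F p V.≈ᵒ G p
      linear-ext F G LF LG F≈G (t , y , x) = begin
        F (t , y , x)                                                    ≈⟨ LF.cong split ⟩
        F ((tm t T.+ᵒ pure (genY one y)) T.+ᵒ pure (genX x))             ≈⟨ sum LF ⟩
        (F (tm t) V.+ᵒ F (pure (genY one y))) V.+ᵒ F (pure (genX x))     ≈⟨ VV.+-cong (VV.+-cong (on-tm t) (F≈G (genY one y))) (F≈G (genX x)) ⟩
        (G (tm t) V.+ᵒ G (pure (genY one y))) V.+ᵒ G (pure (genX x))     ≈⟨ sum LG ⟨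
        G ((tm t T.+ᵒ pure (genY one y)) T.+ᵒ pure (genX x))             ≈⟨ LG.cong split ⟨
        G (t , y , x)                                                    ∎
        where
        open VV.≈-Reasoning
        module LF = IsLinear LF
        module LG = IsLinear LG
        tm : Tm → Car
        tm t = t , Y.0ᵒ , X.0ᵒ
        split : (t , y , x) T.≈ᵒ ((tm t T.+ᵒ pure (genY one y)) T.+ᵒ pure (genX x))
        split = ≈-symᵗ (≈-transᵗ (+-congᵗ (t+0≈t t) ≈-reflᵗ) (t+0≈t t))
              , VY.sym (VY.trans (VY.+-identityʳ _) (VY.+-identityˡ y))
              , VX.sym (VX.trans (VX.+-cong (VX.+-identityˡ _) VX.refl) (VX.+-identityˡ x))
          where
          t+0≈t : ∀ t → (t +ᵗ 0ᵗ) ≈ᵗ t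
          t+0≈t t = ≈-transᵗ (+-commᵗ t 0ᵗ) (+-idˡᵗ t)
        sum : ∀ {H} → IsLinear (X ⊗̄ Y) V H → H ((tm t T.+ᵒ pure (genY one y)) T.+ᵒ pure (genX x)) V.≈ᵒ
                        ((H (tm t) V.+ᵒ H (pure (genY one y))) V.+ᵒ H (pure (genX x)))
        sum LH = VV.trans (IsLinear.+-homo LH _ _) (VV.+-cong (IsLinear.+-homo LH _ _) VV.refl)
        on-tm : ∀ t → F (tm t) V.≈ᵒ G (tm t)
        on-tm 0ᵗ       = VV.trans (0-homo isVectorSpace VV LF) (VV.sym (0-homo isVectorSpace VV LG))
        on-tm (a ⊗ b)  = F≈G (genY (el a) b)
        on-tm (s +ᵗ t) = VV.trans (LF.cong e) (VV.trans (LF.+-homo _ _) (VV.trans (VV.+-cong (on-tm s) (on-tm t))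
                           (VV.sym (VV.trans (LG.cong e) (LG.+-homo _ _)))))
          where e = ≈-reflᵗ , VY.0≈0+0 , VX.0≈0+0
        on-tm (k •ᵗ t) = VV.trans (LF.cong e) (VV.trans (LF.•-homo _ _) (VV.trans (VV.•-cong K.refl (on-tm t))
                           (VV.sym (VV.trans (LG.cong e) (LG.•-homo _ _)))))
          where e = ≈-reflᵗ , VY.sym (VY.•-zeroʳ k) , VX.sym (VX.•-zeroʳ k)

      bilinear-ext : (F G : Car → Car → V.Car) →
                     (∀ q → IsLinear (X ⊗̄ Y) V (λ p → F p q)) → (∀ q → IsLinear (X ⊗̄ Y) V (λ p → G p q)) →
                     (∀ p → IsLinear (X ⊗̄ Y) V (F p)) → (∀ p → IsLinear (X ⊗̄ Y) V (G p)) →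
                     (∀ γ γ' → F (pure γ) (pure γ') V.≈ᵒ G (pure γ) (pure γ')) → ∀ p q → F p q V.≈ᵒ G p q
      bilinear-ext F G LFˡ LGˡ LFʳ LGʳ F≈G p q =
        linear-ext (λ p → F p q) (λ p → G p q) (LFˡ q) (LGˡ q)
          (λ γ → linear-ext (F (pure γ)) (G (pure γ)) (LFʳ (pure γ)) (LGʳ (pure γ)) (F≈G γ) q) p

    open Extension isVectorSpace using () renaming
      (extend to extendᵀ; extend-isLinear to extendᵀ-isLinear; extend-pure to extendᵀ-pure;
       extend-linear-in-family to extendᵀ-linear-in-family)

    embed-*̄-linearˡ : ∀ u' w → IsLinear X (X ⊗̄ Y) (λ a → embed (el a *̄ u') w)
    embed-*̄-linearˡ one    w = embed-isLinearˡ w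
    embed-*̄-linearˡ (el c) w = ∘-isLinear isVectorSpace (*-linearˡ BX c) (embed-isLinearˡ w)

    embed-*̄-linearʳ : ∀ u w → IsLinear X (X ⊗̄ Y) (λ c → embed (u *̄ el c) w)
    embed-*̄-linearʳ one    w = embed-isLinearˡ w
    embed-*̄-linearʳ (el a) w = ∘-isLinear isVectorSpace (*-linearʳ BX a) (embed-isLinearˡ w)

    ⋉1-isLinear : ∀ o → IsLinear Y Y (⋉1 o)
    ⋉1-isLinear ≺ = id-isLinear BY.isVectorSpace
    ⋉1-isLinear · = 0-isLinear BY.isVectorSpace BY.isVectorSpace
    ⋉1-isLinear ≻ = 0-isLinear BY.isVectorSpace BY.isVectorSpace

    1⋉-isLinear : ∀ o → IsLinear Y Y (1⋉ o)
    1⋉-isLinear ≺ = 0-isLinear BY.isVectorSpace BY.isVectorSpace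
    1⋉-isLinear · = 0-isLinear BY.isVectorSpace BY.isVectorSpace
    1⋉-isLinear ≻ = id-isLinear BY.isVectorSpace

    mulGen-multilinearˡ : ∀ o γ' → IsMultilinear (X ⊗̄ Y) (λ γ → mulGen o γ γ')
    mulGen-multilinearˡ o (genY u' y') = record
      { genY-linearʳ = λ u → ∘-isLinear isVectorSpace (BY.mul-linearˡ o y') (embed-isLinear (u *̄ u'))
      ; genY-linearˡ = λ y → embed-*̄-linearˡ u' (Y.mul o y y')
      ; genX-linear = embed-*̄-linearˡ u' (1⋉ o y') }
    mulGen-multilinearˡ o (genX c) = record
      { genY-linearʳ = λ u → ∘-isLinear isVectorSpace (⋉1-isLinear o) (embed-isLinear (u *̄ el c))
      ; genY-linearˡ = λ y → embed-*̄-linearˡ (el c) (⋉1 o y)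
      ; genX-linear = ∘-isLinear isVectorSpace (BX.mul-linearˡ o c) pure-genX-isLinear }

    mulGen-multilinearʳ : ∀ o γ → IsMultilinear (X ⊗̄ Y) (λ γ' → mulGen o γ γ')
    mulGen-multilinearʳ o (genY u y) = record
      { genY-linearʳ = λ u' → ∘-isLinear isVectorSpace (BY.mul-linearʳ o y) (embed-isLinear (u *̄ u'))
      ; genY-linearˡ = λ y' → embed-*̄-linearʳ u (Y.mul o y y')
      ; genX-linear = embed-*̄-linearʳ u (⋉1 o y) }
    mulGen-multilinearʳ o (genX a) = record
      { genY-linearʳ = λ u' → ∘-isLinear isVectorSpace (1⋉-isLinear o) (embed-isLinear (el a *̄ u'))
      ; genY-linearˡ = λ y' → embed-*̄-linearʳ (el a) (1⋉ o y')
      ; genX-linear = ∘-isLinear isVectorSpace (BX.mul-linearʳ o a) pure-genX-isLinear }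

    mulᶜ-multilinearˡ : ∀ o q → IsMultilinear (X ⊗̄ Y) (λ γ → extendᵀ (mulGen o γ) q)
    mulᶜ-multilinearˡ o q = record
      { genY-linearʳ = λ u → extendᵀ-linear-in-family (λ y γ' → mulGen o (genY u y) γ')
                          (λ γ' → IsMultilinear.genY-linearʳ (mulGen-multilinearˡ o γ') u) q
      ; genY-linearˡ = λ y → extendᵀ-linear-in-family (λ a γ' → mulGen o (genY (el a) y) γ')
                          (λ γ' → IsMultilinear.genY-linearˡ (mulGen-multilinearˡ o γ') y) q
      ; genX-linear = extendᵀ-linear-in-family (λ x γ' → mulGen o (genX x) γ')
                    (λ γ' → IsMultilinear.genX-linear (mulGen-multilinearˡ o γ')) q }

    isBilinear : IsBilinear (X ⊗̄ Y)
    isBilinear = record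
      { isVectorSpace = isVectorSpace
      ; mul-linearˡ   = λ o q → extendᵀ-isLinear (mulᶜ-multilinearˡ o q)
      ; mul-linearʳ   = λ o p → extendᵀ-linear-in-family (λ q γ → extendᵀ (mulGen o γ) q)
                                  (λ γ → extendᵀ-isLinear (mulGen-multilinearʳ o γ)) p }

    mul-pure : ∀ o γ γ' → T.mul o (pure γ) (pure γ') T.≈ᵒ mulGen o γ γ'
    mul-pure o γ γ' = VT.trans (extendᵀ-pure (mulᶜ-multilinearˡ o (pure γ')) γ)
                               (extendᵀ-pure (mulGen-multilinearʳ o γ) γ')

    _⋆_ : Gen → Gen → Gen
    genY u y ⋆ genY u' y' = genY (u *̄ u') (y Y.*ᵒ y')
    genY u y ⋆ genX c     = genY (u *̄ el c) y
    genX a   ⋆ genY u' d  = genY (el a *̄ u') d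
    genX a   ⋆ genX c     = genX (a X.*ᵒ c)

    *-pure : ∀ γ γ' → (pure γ T.*ᵒ pure γ') T.≈ᵒ pure (γ ⋆ γ')
    *-pure γ γ' = VT.trans (VT.+-cong (VT.+-cong (mul-pure ≺ γ γ') (mul-pure · γ γ')) (mul-pure ≻ γ γ'))
                           (sum-mulGen γ γ')
      where
      sum-mulGen : ∀ γ γ' → ((mulGen ≺ γ γ' T.+ᵒ mulGen · γ γ') T.+ᵒ mulGen ≻ γ γ') T.≈ᵒ pure (γ ⋆ γ')
      sum-mulGen (genY u y) (genY u' y') = VT.sym (VT.trans (E.+-homo _ _) (VT.+-cong (E.+-homo _ _) VT.refl))
        where module E = IsLinear (embed-isLinear (u *̄ u'))
      sum-mulGen (genY u y) (genX c) = VT.trans (VT.+-cong (VT.+-cong VT.refl (embed-zero (u *̄ el c))) (embed-zero (u *̄ el c)))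
                                         (VT.trans (VT.+-identityʳ _) (VT.+-identityʳ _))
      sum-mulGen (genX a) (genY u' d) = VT.trans (VT.+-cong (VT.trans (VT.+-cong (embed-zero (el a *̄ u')) (embed-zero (el a *̄ u')))
                                          (VT.+-identityˡ _)) VT.refl) (VT.+-identityˡ _)
      sum-mulGen (genX a) (genX c) = VT.sym (VT.trans (P.+-homo _ _) (VT.+-cong (P.+-homo _ _) VT.refl))
        where module P = IsLinear pure-genX-isLinear

  module Associativity {A B C : TriOps K} (bilinearA : IsBilinear A) (bilinearB : IsBilinear B)
                       (bilinearC : IsBilinear C) where
    open Assoc A B C
    private
      module A = TriOps A
      module B = TriOps B
      module C = TriOps C
    module AB   = AugTensorProperties bilinearA bilinearB
    module BC   = AugTensorProperties bilinearB bilinearC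
    module AB-C = AugTensorProperties AB.isBilinear bilinearC
    module A-BC = AugTensorProperties bilinearA BC.isBilinear
    private
      module VBC  = IsVectorSpace BC.isVectorSpace
      module V    = IsVectorSpace A-BC.isVectorSpace
      module ABext  = AB.Extension A-BC.isVectorSpace
      module AB-Cext = AB-C.Extension A-BC.isVectorSpace
    open A-BC.T using () renaming (_≈ᵒ_ to _≈ᴿ_; mul to mulᴿ)
    open AB-C.T using () renaming (mul to mulᴸ)

    factorA : Aug AB.Gen → Aug A.Car
    factorA one                 = one
    factorA (el (AB.genY α _))  = α
    factorA (el (AB.genX a))    = el a

    factorB : Aug AB.Gen → Aug B.Car
    factorB one                 = one
    factorB (el (AB.genY _ b))  = el b
    factorB (el (AB.genX _))    = one

    augPure : Aug AB.Gen → Aug AB.Car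
    augPure one    = one
    augPure (el δ) = el (AB.pure δ)

    _⋆ᵃ_ : Aug AB.Gen → Aug AB.Gen → Aug AB.Gen
    one  ⋆ᵃ one   = one
    one  ⋆ᵃ el δ' = el δ'
    el δ ⋆ᵃ one   = el δ
    el δ ⋆ᵃ el δ' = el (δ AB.⋆ δ')

    -- A pure tensor α ⊗ β ⊗ γ ≠ 1 ⊗ 1 ⊗ 1 of (Ā ⊗ B̄) ⊗ C̄: either γ = c ∈ C and Δ encodes
    -- α ⊗ β (one for 1 ⊗ 1), or γ = 1 and α ⊗ β ≠ 1 ⊗ 1.
    data PureTriple : Set where
      _⊗ᶜ_ : Aug AB.Gen → C.Car → PureTriple
      _⊗1  : AB.Gen → PureTriple

    toGenᴸ : PureTriple → AB-C.Gen
    toGenᴸ (Δ ⊗ᶜ c) = AB-C.genY (augPure Δ) c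
    toGenᴸ (δ ⊗1)   = AB-C.genX (AB.pure δ)

    toGenᴿ : PureTriple → A-BC.Gen
    toGenᴿ (Δ ⊗ᶜ c)          = A-BC.genY (factorA Δ) (BC.embed (factorB Δ) c)
    toGenᴿ (AB.genY α b ⊗1)  = A-BC.genY α (BC.pure (BC.genX b))
    toGenᴿ (AB.genX a ⊗1)    = A-BC.genX a

    φ-triple : PureTriple → A-BC.Car
    φ-triple t = A-BC.pure (toGenᴿ t)

    -- φ is definitionally the extension of φ-gen, and φgen _ c and φXY1 are the extensions
    -- over A ⊗̄ B of δ ↦ φ-triple (el δ ⊗ᶜ c) and δ ↦ φ-triple (δ ⊗1).
    φ-gen : AB-C.Gen → A-BC.Car
    φ-gen (AB-C.genY one c)    = φ11c c
    φ-gen (AB-C.genY (el P) c) = φgen P c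
    φ-gen (AB-C.genX P)        = φXY1 P

    φ-⊗ᶜ-multilinear : ∀ c → AB.IsMultilinear (A ⊗̄ (B ⊗̄ C)) (λ δ → φ-triple (el δ ⊗ᶜ c))
    φ-⊗ᶜ-multilinear c = record
      { genY-linearʳ = λ α → ∘-isLinear A-BC.isVectorSpace (BC.embed-isLinearˡ c) (A-BC.embed-isLinear α)
      ; genY-linearˡ = λ _ → A-BC.embed-isLinearˡ _
      ; genX-linear = A-BC.embed-isLinearˡ _ }

    φ-⊗1-multilinear : AB.IsMultilinear (A ⊗̄ (B ⊗̄ C)) (λ δ → φ-triple (δ ⊗1))
    φ-⊗1-multilinear = record
      { genY-linearʳ = λ α → ∘-isLinear A-BC.isVectorSpace BC.pure-genX-isLinear (A-BC.embed-isLinear α)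
      ; genY-linearˡ = λ _ → A-BC.embed-isLinearˡ _
      ; genX-linear = A-BC.pure-genX-isLinear }

    φ-gen-multilinear : AB-C.IsMultilinear (A ⊗̄ (B ⊗̄ C)) φ-gen
    φ-gen-multilinear = record
      { genY-linearʳ = genY-linearʳ
      ; genY-linearˡ = λ c → ABext.extend-isLinear (φ-⊗ᶜ-multilinear c)
      ; genX-linear = ABext.extend-isLinear φ-⊗1-multilinear }
      where
      ⊗ᶜ-linear : ∀ Δ → IsLinear C (A ⊗̄ (B ⊗̄ C)) (λ c → φ-triple (Δ ⊗ᶜ c))
      ⊗ᶜ-linear Δ = ∘-isLinear A-BC.isVectorSpace (BC.embed-isLinear (factorB Δ)) (A-BC.embed-isLinear (factorA Δ))
      genY-linearʳ : ∀ u → IsLinear C (A ⊗̄ (B ⊗̄ C)) (λ c → φ-gen (AB-C.genY u c))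
      genY-linearʳ one    = ⊗ᶜ-linear one
      genY-linearʳ (el P) = ABext.extend-linear-in-family (λ c δ → φ-triple (el δ ⊗ᶜ c)) (λ δ → ⊗ᶜ-linear (el δ)) P

    φ-isLinear : IsLinear ((A ⊗̄ B) ⊗̄ C) (A ⊗̄ (B ⊗̄ C)) φ
    φ-isLinear = AB-Cext.extend-isLinear φ-gen-multilinear

    φ-gen-triple : ∀ t → φ-gen (toGenᴸ t) ≈ᴿ φ-triple t
    φ-gen-triple (one ⊗ᶜ c)  = V.refl
    φ-gen-triple (el δ ⊗ᶜ c) = ABext.extend-pure (φ-⊗ᶜ-multilinear c) δ
    φ-gen-triple (δ ⊗1)      = ABext.extend-pure φ-⊗1-multilinear δ

    -- AugTensor is instantiated separately for each pair of factors, so its operations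
    -- on a shared factor agree only after case analysis.
    *̄-coincide : ∀ u u' → u AB.*̄ u' ≡ u A-BC.*̄ u'
    *̄-coincide one    one    = ≡.refl
    *̄-coincide one    (el _) = ≡.refl
    *̄-coincide (el _) one    = ≡.refl
    *̄-coincide (el _) (el _) = ≡.refl

    ⋉1-coincide : ∀ o c → AB-C.⋉1 o c ≡ BC.⋉1 o c
    ⋉1-coincide ≺ _ = ≡.refl
    ⋉1-coincide · _ = ≡.refl
    ⋉1-coincide ≻ _ = ≡.refl

    1⋉-coincide : ∀ o c → AB-C.1⋉ o c ≡ BC.1⋉ o c
    1⋉-coincide ≺ _ = ≡.refl
    1⋉-coincide · _ = ≡.refl
    1⋉-coincide ≻ _ = ≡.refl

    pure-genX-⋉1 : ∀ o b → BC.pure (BC.genX (AB.⋉1 o b)) ≡ A-BC.⋉1 o (BC.pure (BC.genX b))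
    pure-genX-⋉1 ≺ _ = ≡.refl
    pure-genX-⋉1 · _ = ≡.refl
    pure-genX-⋉1 ≻ _ = ≡.refl

    pure-genX-1⋉ : ∀ o b → BC.pure (BC.genX (AB.1⋉ o b)) ≡ A-BC.1⋉ o (BC.pure (BC.genX b))
    pure-genX-1⋉ ≺ _ = ≡.refl
    pure-genX-1⋉ · _ = ≡.refl
    pure-genX-1⋉ ≻ _ = ≡.refl

    embed-⋉1 : ∀ o v c → BC.embed v (BC.⋉1 o c) BC.T.≈ᵒ A-BC.⋉1 o (BC.embed v c)
    embed-⋉1 ≺ v c = VBC.refl
    embed-⋉1 · v c = BC.embed-zero v
    embed-⋉1 ≻ v c = BC.embed-zero v

    embed-1⋉ : ∀ o v c → BC.embed v (BC.1⋉ o c) BC.T.≈ᵒ A-BC.1⋉ o (BC.embed v c)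
    embed-1⋉ ≺ v c = BC.embed-zero v
    embed-1⋉ · v c = BC.embed-zero v
    embed-1⋉ ≻ v c = VBC.refl

    factorA-⋆ : ∀ Δ Δ' → factorA (Δ ⋆ᵃ Δ') ≡ factorA Δ A-BC.*̄ factorA Δ'
    factorA-⋆ one    one    = ≡.refl
    factorA-⋆ one    (el δ') = ≡.sym (A-BC.*̄-identityˡ _)
    factorA-⋆ (el δ) one    = ≡.sym (A-BC.*̄-identityʳ _)
    factorA-⋆ (el (AB.genY u _)) (el (AB.genY u' _)) = *̄-coincide u u'
    factorA-⋆ (el (AB.genY u _)) (el (AB.genX a'))   = *̄-coincide u (el a')
    factorA-⋆ (el (AB.genX a))   (el (AB.genY u' _)) = *̄-coincide (el a) u'
    factorA-⋆ (el (AB.genX _))   (el (AB.genX _))    = ≡.refl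

    factorB-⋆ : ∀ Δ Δ' → factorB (Δ ⋆ᵃ Δ') ≡ factorB Δ BC.*̄ factorB Δ'
    factorB-⋆ one    one    = ≡.refl
    factorB-⋆ one    (el δ') = ≡.sym (BC.*̄-identityˡ _)
    factorB-⋆ (el δ) one    = ≡.sym (BC.*̄-identityʳ _)
    factorB-⋆ (el (AB.genY _ _)) (el (AB.genY _ _)) = ≡.refl
    factorB-⋆ (el (AB.genY _ _)) (el (AB.genX _))   = ≡.refl
    factorB-⋆ (el (AB.genX _))   (el (AB.genY _ _)) = ≡.refl
    factorB-⋆ (el (AB.genX _))   (el (AB.genX _))   = ≡.refl

    augPure-⋆ : ∀ Δ Δ' w → AB-C.embed (augPure Δ AB-C.*̄ augPure Δ') w AB-C.T.≈ᵒ AB-C.embed (augPure (Δ ⋆ᵃ Δ')) w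
    augPure-⋆ one    one    w = IsVectorSpace.refl AB-C.isVectorSpace
    augPure-⋆ one    (el _) w = IsVectorSpace.refl AB-C.isVectorSpace
    augPure-⋆ (el _) one    w = IsVectorSpace.refl AB-C.isVectorSpace
    augPure-⋆ (el δ) (el δ') w = IsLinear.cong (AB-C.embed-isLinearˡ w) (AB.*-pure δ δ')

    φ-embed-⋆ : ∀ Δ Δ' {w x} → BC.embed (factorB Δ BC.*̄ factorB Δ') w BC.T.≈ᵒ x →
                φ (AB-C.embed (augPure Δ AB-C.*̄ augPure Δ') w) ≈ᴿ A-BC.embed (factorA Δ A-BC.*̄ factorA Δ') x
    φ-embed-⋆ Δ Δ' {w} {x} e = begin
      φ (AB-C.embed (augPure Δ AB-C.*̄ augPure Δ') w)    ≈⟨ IsLinear.cong φ-isLinear (augPure-⋆ Δ Δ' w) ⟩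
      φ (AB-C.pure (toGenᴸ ((Δ ⋆ᵃ Δ') ⊗ᶜ w)))            ≈⟨ AB-Cext.extend-pure φ-gen-multilinear (toGenᴸ ((Δ ⋆ᵃ Δ') ⊗ᶜ w)) ⟩
      φ-gen (toGenᴸ ((Δ ⋆ᵃ Δ') ⊗ᶜ w))                     ≈⟨ φ-gen-triple ((Δ ⋆ᵃ Δ') ⊗ᶜ w) ⟩
      φ-triple ((Δ ⋆ᵃ Δ') ⊗ᶜ w)                          ≡⟨ ≡.cong₂ (λ u v → A-BC.embed u (BC.embed v w)) (factorA-⋆ Δ Δ') (factorB-⋆ Δ Δ') ⟩
      A-BC.embed (factorA Δ A-BC.*̄ factorA Δ') (BC.embed (factorB Δ BC.*̄ factorB Δ') w)
                                                         ≈⟨ A-BC.embed-cong (factorA Δ A-BC.*̄ factorA Δ') ≡.refl e ⟩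
      A-BC.embed (factorA Δ A-BC.*̄ factorA Δ') x        ∎
      where open V.≈-Reasoning

    φ-⊗1-mulGen : ∀ o δ δ' → ABext.extend (λ δ → φ-triple (δ ⊗1)) (AB.mulGen o δ δ') ≈ᴿ
                              A-BC.mulGen o (toGenᴿ (δ ⊗1)) (toGenᴿ (δ' ⊗1))
    φ-⊗1-mulGen o (AB.genY u b) (AB.genY u' b') = V.trans
      (ABext.extend-pure φ-⊗1-multilinear (AB.genY (u AB.*̄ u') (B.mul o b b')))
      (A-BC.embed-cong (u AB.*̄ u') (*̄-coincide u u') (VBC.sym (BC.mul-pure o (BC.genX b) (BC.genX b'))))
    φ-⊗1-mulGen o (AB.genY u b) (AB.genX a') = V.trans
      (ABext.extend-pure φ-⊗1-multilinear (AB.genY (u AB.*̄ el a') (AB.⋉1 o b)))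
      (A-BC.embed-cong (u AB.*̄ el a') (*̄-coincide u (el a')) (VBC.reflexive (pure-genX-⋉1 o b)))
    φ-⊗1-mulGen o (AB.genX a) (AB.genY u' b') = V.trans
      (ABext.extend-pure φ-⊗1-multilinear (AB.genY (el a AB.*̄ u') (AB.1⋉ o b')))
      (A-BC.embed-cong (el a AB.*̄ u') (*̄-coincide (el a) u') (VBC.reflexive (pure-genX-1⋉ o b')))
    φ-⊗1-mulGen o (AB.genX a) (AB.genX a') =
      ABext.extend-pure φ-⊗1-multilinear (AB.genX (A.mul o a a'))

    φ-mulGen-triple : ∀ o t t' → φ (AB-C.mulGen o (toGenᴸ t) (toGenᴸ t')) ≈ᴿ A-BC.mulGen o (toGenᴿ t) (toGenᴿ t')
    φ-mulGen-triple o (Δ ⊗ᶜ c) (Δ' ⊗ᶜ c') =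
      φ-embed-⋆ Δ Δ' (VBC.sym (BC.mul-pure o (BC.genY (factorB Δ) c) (BC.genY (factorB Δ') c')))
    φ-mulGen-triple o (Δ ⊗ᶜ c) (AB.genY α' b' ⊗1) = φ-embed-⋆ Δ (el (AB.genY α' b')) (begin
      BC.embed (factorB Δ BC.*̄ el b') (AB-C.⋉1 o c)    ≡⟨ ≡.cong (BC.embed (factorB Δ BC.*̄ el b')) (⋉1-coincide o c) ⟩
      BC.mulGen o (BC.genY (factorB Δ) c) (BC.genX b')  ≈⟨ BC.mul-pure o (BC.genY (factorB Δ) c) (BC.genX b') ⟨
      BC.T.mul o (BC.embed (factorB Δ) c) (BC.pure (BC.genX b')) ∎)
      where open VBC.≈-Reasoning
    φ-mulGen-triple o (Δ ⊗ᶜ c) (AB.genX a' ⊗1) = φ-embed-⋆ Δ (el (AB.genX a')) (begin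
      BC.embed (factorB Δ BC.*̄ one) (AB-C.⋉1 o c)      ≡⟨ ≡.cong₂ BC.embed (BC.*̄-identityʳ (factorB Δ)) (⋉1-coincide o c) ⟩
      BC.embed (factorB Δ) (BC.⋉1 o c)                  ≈⟨ embed-⋉1 o (factorB Δ) c ⟩
      A-BC.⋉1 o (BC.embed (factorB Δ) c)                ∎)
      where open VBC.≈-Reasoning
    φ-mulGen-triple o (AB.genY α b ⊗1) (Δ' ⊗ᶜ c') = φ-embed-⋆ (el (AB.genY α b)) Δ' (begin
      BC.embed (el b BC.*̄ factorB Δ') (AB-C.1⋉ o c')   ≡⟨ ≡.cong (BC.embed (el b BC.*̄ factorB Δ')) (1⋉-coincide o c') ⟩
      BC.mulGen o (BC.genX b) (BC.genY (factorB Δ') c') ≈⟨ BC.mul-pure o (BC.genX b) (BC.genY (factorB Δ') c') ⟨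
      BC.T.mul o (BC.pure (BC.genX b)) (BC.embed (factorB Δ') c') ∎)
      where open VBC.≈-Reasoning
    φ-mulGen-triple o (AB.genX a ⊗1) (Δ' ⊗ᶜ c') = φ-embed-⋆ (el (AB.genX a)) Δ' (begin
      BC.embed (one BC.*̄ factorB Δ') (AB-C.1⋉ o c')    ≡⟨ ≡.cong₂ BC.embed (BC.*̄-identityˡ (factorB Δ')) (1⋉-coincide o c') ⟩
      BC.embed (factorB Δ') (BC.1⋉ o c')                ≈⟨ embed-1⋉ o (factorB Δ') c' ⟩
      A-BC.1⋉ o (BC.embed (factorB Δ') c')              ∎)
      where open VBC.≈-Reasoning
    φ-mulGen-triple o (δ ⊗1) (δ' ⊗1) = begin
      φ (AB-C.pure (AB-C.genX (AB.T.mul o (AB.pure δ) (AB.pure δ'))))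
        ≈⟨ AB-Cext.extend-pure φ-gen-multilinear (AB-C.genX (AB.T.mul o (AB.pure δ) (AB.pure δ'))) ⟩
      ABext.extend (λ δ → φ-triple (δ ⊗1)) (AB.T.mul o (AB.pure δ) (AB.pure δ'))
        ≈⟨ IsLinear.cong (ABext.extend-isLinear φ-⊗1-multilinear) (AB.mul-pure o δ δ') ⟩
      ABext.extend (λ δ → φ-triple (δ ⊗1)) (AB.mulGen o δ δ')
        ≈⟨ φ-⊗1-mulGen o δ δ' ⟩
      A-BC.mulGen o (toGenᴿ (δ ⊗1)) (toGenᴿ (δ' ⊗1)) ∎
      where open V.≈-Reasoning

    triples-suffice : (F G : AB-C.Gen → A-BC.Car) →
                      AB-C.IsMultilinear (A ⊗̄ (B ⊗̄ C)) F → AB-C.IsMultilinear (A ⊗̄ (B ⊗̄ C)) G →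
                      (∀ t → F (toGenᴸ t) ≈ᴿ G (toGenᴸ t)) → ∀ γ → F γ ≈ᴿ G γ
    triples-suffice F G MF MG F≈G (AB-C.genY one c)    = F≈G (one ⊗ᶜ c)
    triples-suffice F G MF MG F≈G (AB-C.genY (el P) c) =
      ABext.linear-ext (λ P → F (AB-C.genY (el P) c)) (λ P → G (AB-C.genY (el P) c))
        (AB-C.IsMultilinear.genY-linearˡ MF c) (AB-C.IsMultilinear.genY-linearˡ MG c) (λ δ → F≈G (el δ ⊗ᶜ c)) P
    triples-suffice F G MF MG F≈G (AB-C.genX P) =
      ABext.linear-ext (λ P → F (AB-C.genX P)) (λ P → G (AB-C.genX P))
        (AB-C.IsMultilinear.genX-linear MF) (AB-C.IsMultilinear.genX-linear MG) (λ δ → F≈G (δ ⊗1)) P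

    φ-mulGen : ∀ o γ γ' → φ (AB-C.mulGen o γ γ') ≈ᴿ mulᴿ o (φ-gen γ) (φ-gen γ')
    φ-mulGen o γ γ' =
      triples-suffice (λ γ → φ (AB-C.mulGen o γ γ')) (λ γ → mulᴿ o (φ-gen γ) (φ-gen γ'))
        (AB-C.∘-isMultilinear A-BC.isVectorSpace φ-isLinear (AB-C.mulGen-multilinearˡ o γ'))
        (AB-C.∘-isMultilinear A-BC.isVectorSpace (IsBilinear.mul-linearˡ A-BC.isBilinear o (φ-gen γ')) φ-gen-multilinear)
        (λ t → triples-suffice (λ γ' → φ (AB-C.mulGen o (toGenᴸ t) γ')) (λ γ' → mulᴿ o (φ-gen (toGenᴸ t)) (φ-gen γ'))
          (AB-C.∘-isMultilinear A-BC.isVectorSpace φ-isLinear (AB-C.mulGen-multilinearʳ o (toGenᴸ t)))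
          (AB-C.∘-isMultilinear A-BC.isVectorSpace (IsBilinear.mul-linearʳ A-BC.isBilinear o (φ-gen (toGenᴸ t))) φ-gen-multilinear)
          (λ t' → on-triples t t') γ')
        γ
      where
      on-triples : ∀ t t' → φ (AB-C.mulGen o (toGenᴸ t) (toGenᴸ t')) ≈ᴿ mulᴿ o (φ-gen (toGenᴸ t)) (φ-gen (toGenᴸ t'))
      on-triples t t' = begin
        φ (AB-C.mulGen o (toGenᴸ t) (toGenᴸ t'))                ≈⟨ φ-mulGen-triple o t t' ⟩
        A-BC.mulGen o (toGenᴿ t) (toGenᴿ t')                   ≈⟨ A-BC.mul-pure o (toGenᴿ t) (toGenᴿ t') ⟨
        mulᴿ o (φ-triple t) (φ-triple t')                       ≈⟨ IsBilinear.mul-cong A-BC.isBilinear o (φ-gen-triple t) (φ-gen-triple t') ⟨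
        mulᴿ o (φ-gen (toGenᴸ t)) (φ-gen (toGenᴸ t'))          ∎
        where open V.≈-Reasoning

    φ-mul : ∀ (o : Op) (p q : TriOps.Car ((A ⊗̄ B) ⊗̄ C)) →
      TriOps._≈ᵒ_ (A ⊗̄ (B ⊗̄ C)) (φ (TriOps.mul ((A ⊗̄ B) ⊗̄ C) o p q)) (TriOps.mul (A ⊗̄ (B ⊗̄ C)) o (φ p) (φ q))
    φ-mul o = AB-Cext.bilinear-ext (λ p q → φ (mulᴸ o p q)) (λ p q → mulᴿ o (φ p) (φ q))
      (λ q → ∘-isLinear A-BC.isVectorSpace (L.mul-linearˡ o q) φ-isLinear)
      (λ q → ∘-isLinear A-BC.isVectorSpace φ-isLinear (R.mul-linearˡ o (φ q)))
      (λ p → ∘-isLinear A-BC.isVectorSpace (L.mul-linearʳ o p) φ-isLinear)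
      (λ p → ∘-isLinear A-BC.isVectorSpace φ-isLinear (R.mul-linearʳ o (φ p)))
      on-pure
      where
      module L = IsBilinear AB-C.isBilinear
      module R = IsBilinear A-BC.isBilinear
      φ-pure : ∀ γ → φ (AB-C.pure γ) ≈ᴿ φ-gen γ
      φ-pure = AB-Cext.extend-pure φ-gen-multilinear
      on-pure : ∀ γ γ' → φ (mulᴸ o (AB-C.pure γ) (AB-C.pure γ')) ≈ᴿ mulᴿ o (φ (AB-C.pure γ)) (φ (AB-C.pure γ'))
      on-pure γ γ' = begin
        φ (mulᴸ o (AB-C.pure γ) (AB-C.pure γ'))           ≈⟨ IsLinear.cong φ-isLinear (AB-C.mul-pure o γ γ') ⟩
        φ (AB-C.mulGen o γ γ')                             ≈⟨ φ-mulGen o γ γ' ⟩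
        mulᴿ o (φ-gen γ) (φ-gen γ')                        ≈⟨ R.mul-cong o (φ-pure γ) (φ-pure γ') ⟨
        mulᴿ o (φ (AB-C.pure γ)) (φ (AB-C.pure γ'))        ∎
        where open V.≈-Reasoning

mainTheorem4 : (K : Field) (A B C : TriAlg K) →
    let open Assoc (TriAlg.ops A) (TriAlg.ops B) (TriAlg.ops C) in
    ∀ (o : Op) (p q : TriOps.Car ((TriAlg.ops A ⊗̄ TriAlg.ops B) ⊗̄ TriAlg.ops C)) →
      TriOps._≈ᵒ_ (TriAlg.ops A ⊗̄ (TriAlg.ops B ⊗̄ TriAlg.ops C))
        (φ (TriOps.mul ((TriAlg.ops A ⊗̄ TriAlg.ops B) ⊗̄ TriAlg.ops C) o p q))
        (TriOps.mul (TriAlg.ops A ⊗̄ (TriAlg.ops B ⊗̄ TriAlg.ops C)) o (φ p) (φ q))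
mainTheorem4 K A B C =
  Associativity.φ-mul (triAlg-isBilinear A) (triAlg-isBilinear B) (triAlg-isBilinear C)
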